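{- Let $(u_n)_{n\geq 1}$ be a sequence in which every nonzero ZF-word appears exactly once, and which is length-increasing, i.e. the position (counted from the right) of the leftmost $1$ of $u_n$ is nondecreasing in $n$. Then for every $n\geq 1$, $h(u_n,u_{n+1})\geq h(g_n,g_{n+1})$, where $(g_n)$ is the list defined below.
   Context: A ZF-word is a binary word with no two consecutive $1$s; words differing only by leading zeros are identified, and a word is nonzero if it contains a $1$. For a list $\mathcal{L}$ of words: $w\mathcal{L}$ prefixes $w$ to each element; $\mathcal{L}'$ removes the leftmost letter of each element; $\overline{\mathcal{L}}$ is the list reversed; $+$ is concatenation of lists. Define $\mathcal{N}_0=\varnothing$, $\mathcal{N}_1=(1)$, and for $n\geq 2$, $\mathcal{N}_n=10\overline{\mathcal{N}_{n-1}'}+10\overline{\mathcal{N}_{n-2}}$; let $(g_1,g_2,\dots)=\mathcal{N}_1+\mathcal{N}_2+\cdots$. The Hamming distance $h(w,w')$ is the number of positions where $w,w'$ differ after padding the shorter word with leading zeros. -}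

module Defs where

open import Data.Bool using (Bool; true; false)
open import Data.Nat using (ℕ; zero; suc; _+_; _≤_)
open import Data.List using (List; []; _∷_; _++_; map; reverse; length)
open import Data.Product using (_×_; ∃-syntax)
open import Relation.Binary.PropositionalEquality using (_≡_)
open import Data.List.Membership.Propositional using (_∈_)

-- A binary word, written left to right (head = leftmost letter).
Word : Set
Word = List Bool

data ZF : Word → Set where
  zf-[]   : ZF []
  zf-0    : ∀ {w} → ZF w → ZF (false ∷ w)
  zf-1    : ZF (true ∷ [])
  zf-10   : ∀ {w} → ZF w → ZF (true ∷ false ∷ w)

Nonzero : Word → Set
Nonzero w = true ∈ w

strip : Word → Word
strip [] = []
strip (false ∷ w) = strip w
strip (true ∷ w) = true ∷ w

_≈w_ : Word → Word → Set
w ≈w w' = strip w ≡ strip w'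

-- Position (from the right, 1-based) of the leftmost 1; 0 for the zero word.
lead : Word → ℕ
lead w = length (strip w)

-- Hamming distance after padding the shorter word with leading zeros.
-- Works on reversed words (rightmost letter first).
private
  b2n : Bool → ℕ
  b2n true = 1
  b2n false = 0

  diff : Bool → Bool → ℕ
  diff true false = 1
  diff false true = 1
  diff _ _ = 0

  hamRev : Word → Word → ℕ
  hamRev [] [] = 0
  hamRev (x ∷ a) [] = b2n x + hamRev a []
  hamRev [] (y ∷ b) = b2n y + hamRev [] b
  hamRev (x ∷ a) (y ∷ b) = diff x y + hamRev a b

ham : Word → Word → ℕ
ham w w' = hamRev (reverse w) (reverse w')

private
  tail' : Word → Word
  tail' [] = []
  tail' (_ ∷ w) = w

primeL : List Word → List Word
primeL = map tail'

pre10 : List Word → List Word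
pre10 = map (λ w → true ∷ false ∷ w)

N : ℕ → List Word
N zero = []
N (suc zero) = (true ∷ []) ∷ []
N (suc (suc n)) = pre10 (reverse (primeL (N (suc n)))) ++ pre10 (reverse (N n))

Nupto : ℕ → List Word
Nupto zero = []
Nupto (suc m) = Nupto m ++ N (suc m)

private
  nth : List Word → ℕ → Word
  nth [] _ = []
  nth (x ∷ _) zero = x
  nth (_ ∷ xs) (suc k) = nth xs k

-- g n for n ≥ 1 (1-indexed): the n-th element of N_1 + N_2 + ...
-- Since each N_k (k ≥ 1) is nonempty, N_1 + ... + N_n has ≥ n elements.
g : ℕ → Word
g zero = []
g (suc k) = nth (Nupto (suc k)) k

module Submission where

-- Both g and u list the nonzero ZF words by nondecreasing length, and exactly fib (k + 2) − 1 of
-- them have length at most k, since the Zeckendorf value identifies the ZF words of length k with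
-- the numbers below fib (k + 2); hence g n and u n always have the same length. Each block N_k is a
-- Gray code: N_{k+2} is built from N_{k+1} and N_k by reversing and prefixing 10, which preserves
-- distances, and the seam between its two halves changes one letter. So h(g_n, g_{n+1}) ≤ 1 except
-- where the length grows from k to k + 1, where the pair is 1x, 10x at distance 2. In u consecutive
-- words are distinct, and where the length grows by one the ZF condition makes the new word start
-- with 10 against the 1 of the old one, so at least two letters differ.

open import Defs
open import Data.Bool using (true; false)
open import Data.Empty using (⊥-elim)
open import Data.Fin using (Fin; toℕ; fromℕ<)
open import Data.Fin.Properties using (injective⇒≤; toℕ-fromℕ<; toℕ-injective; toℕ<n)
open import Data.List using (List; []; _∷_; _++_; _∷ʳ_; map; reverse; length; drop; head; last)
open import Data.List.Properties
  using (unfold-reverse; reverse-involutive; reverse-map; map-∘; length-++; length-reverse; length-map;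
         ++-assoc; ++-identityʳ; head-map; last-map)
open import Data.List.Membership.Propositional using (_∈_)
open import Data.List.Relation.Unary.All as All using (All; []; _∷_)
import Data.List.Relation.Unary.All.Properties as All
open import Data.List.Relation.Unary.Any using (here; there)
import Data.List.Relation.Unary.Any.Properties as Any
open import Data.List.Relation.Unary.Linked as Linked using (Linked; []; [-]; _∷_)
import Data.List.Relation.Unary.Linked.Properties as Linked
open import Data.Maybe using (just)
import Data.Maybe as Maybe
open import Data.Maybe.Relation.Binary.Connected as Connected using (Connected; just; nothing-just)
open import Data.Nat
open import Data.Nat.Properties
open import Data.Product using (_×_; _,_; proj₁; proj₂; ∃; ∃-syntax)
open import Data.Sum using (_⊎_; inj₁; inj₂; [_,_]′)
open import Function using (_∘_; _⇔_; mk⇔; Equivalence)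
import Function.Properties.Equivalence as ⇔
open import Relation.Binary.Definitions using (Symmetric; tri<; tri≈; tri>)
open import Relation.Binary.PropositionalEquality

monotone-by-steps : (f : ℕ → ℕ) → (∀ n → f n ≤ f (suc n)) → ∀ {m n} → m ≤ n → f m ≤ f n
monotone-by-steps f step {m} m≤n = go (≤⇒≤′ m≤n)
  where
  go : ∀ {n} → m ≤′ n → f m ≤ f n
  go (≤′-reflexive refl) = ≤-refl
  go (≤′-step m≤′n) = ≤-trans (go m≤′n) (step _)

injection⇒≤ : ∀ {m n} (f : Fin m → ℕ) → (∀ i → f i < n) → (∀ i j → f i ≡ f j → i ≡ j) → m ≤ n
injection⇒≤ f f<n f-injective = injective⇒≤ {f = λ i → fromℕ< (f<n i)} λ {i} {j} eq →
  f-injective i j (trans (sym (toℕ-fromℕ< (f<n i))) (trans (cong toℕ eq) (toℕ-fromℕ< (f<n j))))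

≤-determined : ∀ {a b} → (∀ k → a ≤ k ⇔ b ≤ k) → a ≡ b
≤-determined a⇔b = ≤-antisym (Equivalence.from (a⇔b _) ≤-refl) (Equivalence.to (a⇔b _) ≤-refl)

module _ {A : Set} where

  last-∷ʳ : ∀ xs {x : A} → last (xs ∷ʳ x) ≡ just x
  last-∷ʳ [] = refl
  last-∷ʳ (y ∷ []) = refl
  last-∷ʳ (y ∷ z ∷ xs) = last-∷ʳ (z ∷ xs)

  last-reverse : ∀ (xs : List A) → last (reverse xs) ≡ head xs
  last-reverse [] = refl
  last-reverse (x ∷ xs) = trans (cong last (unfold-reverse x xs)) (last-∷ʳ (reverse xs))

  head-reverse : ∀ (xs : List A) → head (reverse xs) ≡ last xs
  head-reverse xs = trans (sym (last-reverse (reverse xs))) (cong last (reverse-involutive xs))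

  head-++ : ∀ xs {ys} {x : A} → head xs ≡ just x → head (xs ++ ys) ≡ just x
  head-++ (y ∷ xs) eq = eq

  last-++ : ∀ xs {ys} {y : A} → last ys ≡ just y → last (xs ++ ys) ≡ just y
  last-++ [] eq = eq
  last-++ (x ∷ []) {_ ∷ _} eq = eq
  last-++ (x ∷ z ∷ xs) eq = last-++ (z ∷ xs) eq

  last≡just⇒head≡just : ∀ (xs : List A) {x} → last xs ≡ just x → ∃ λ h → head xs ≡ just h
  last≡just⇒head≡just (h ∷ _) _ = h , refl

  All-reverse : ∀ {P : A → Set} {xs} → All P xs → All P (reverse xs)
  All-reverse ps = All.tabulate (All.lookup ps ∘ Any.reverse⁻)

  Linked-map-All : ∀ {P : A → Set} {R S : A → A → Set} → (∀ {x y} → P x → P y → R x y → S x y)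
                   → ∀ {xs} → All P xs → Linked R xs → Linked S xs
  Linked-map-All f _ [] = []
  Linked-map-All f _ [-] = [-]
  Linked-map-All f (px ∷ py ∷ ps) (Rxy ∷ Rxs) = f px py Rxy ∷ Linked-map-All f (py ∷ ps) Rxs

  Linked-reverse : ∀ {R : A → A → Set} → Symmetric R → ∀ {xs} → Linked R xs → Linked R (reverse xs)
  Linked-reverse R-sym {[]} [] = []
  Linked-reverse {R} R-sym {x ∷ xs} Rxs = subst (Linked R) (sym (unfold-reverse x xs))
    (Linked.++⁺ (Linked-reverse R-sym (Linked.tail Rxs))
                (subst (λ y → Connected R y (just x)) (sym (last-reverse xs))
                       (Connected.sym R-sym (Linked.head′ Rxs)))
                [-])

-- Defs keeps hamRev and nth private: each metavariable below is solved to the private function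
-- by unifying the equation that follows it with its definition.
mutual
  hamRev : Word → Word → ℕ
  hamRev = _

  ham-reverse : ∀ w v → ham w v ≡ hamRev (reverse w) (reverse v)
  ham-reverse w v with reverse w | reverse v
  ... | a | b = refl

mutual
  nth : List Word → ℕ → Word
  nth = _

  g-suc : ∀ k → g (suc k) ≡ nth (Nupto (suc k)) k
  g-suc k with Nupto k ++ N (suc k)
  ... | xs = refl

lead≤length : ∀ w → lead w ≤ length w
lead≤length [] = z≤n
lead≤length (false ∷ w) = m≤n⇒m≤1+n (lead≤length w)
lead≤length (true ∷ w) = ≤-refl

ZF-strip : ∀ {w} → ZF w → ZF (strip w)
ZF-strip zf-[] = zf-[]
ZF-strip (zf-0 z) = ZF-strip z
ZF-strip zf-1 = zf-1
ZF-strip (zf-10 z) = zf-10 z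

strip-++ : ∀ w z → strip (w ++ z) ≡ strip (strip w ++ z)
strip-++ [] z = refl
strip-++ (false ∷ w) z = strip-++ w z
strip-++ (true ∷ w) z = refl

≈w-++ʳ : ∀ {w w'} z → w ≈w w' → (w ++ z) ≈w (w' ++ z)
≈w-++ʳ {w} {w'} z eq =
  trans (strip-++ w z) (trans (cong (λ s → strip (s ++ z)) eq) (sym (strip-++ w' z)))

strip≡[]⊎nonzero : ∀ w → strip w ≡ [] ⊎ Nonzero w
strip≡[]⊎nonzero [] = inj₁ refl
strip≡[]⊎nonzero (true ∷ w) = inj₂ (here refl)
strip≡[]⊎nonzero (false ∷ w) with strip≡[]⊎nonzero w
... | inj₁ eq = inj₁ eq
... | inj₂ nz = inj₂ (there nz)

nonzero⇒lead-pos : ∀ {w} → Nonzero w → 1 ≤ lead w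
nonzero⇒lead-pos {true ∷ w} _ = s≤s z≤n
nonzero⇒lead-pos {false ∷ w} (there nz) = nonzero⇒lead-pos nz

strip-lead-pos : ∀ w → 1 ≤ lead w → ∃ λ a → strip w ≡ true ∷ a
strip-lead-pos (false ∷ w) pos = strip-lead-pos w pos
strip-lead-pos (true ∷ w) _ = w , refl

prepend10 : Word → Word
prepend10 w = true ∷ false ∷ w

-- Zeckendorf values

fib : ℕ → ℕ
fib zero = 0
fib (suc zero) = 1
fib (suc (suc n)) = fib (suc n) + fib n

fib-mono : ∀ {m n} → m ≤ n → fib m ≤ fib n
fib-mono = monotone-by-steps fib step
  where
  step : ∀ n → fib n ≤ fib (suc n)
  step zero = z≤n
  step (suc n) = m≤m+n _ _

-- On ZF words of length k, value is a bijection onto the numbers below fib (2 + k).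
value : Word → ℕ
value [] = 0
value (false ∷ w) = value w
value (true ∷ w) = fib (2 + length w) + value w

value-strip : ∀ w → value (strip w) ≡ value w
value-strip [] = refl
value-strip (false ∷ w) = value-strip w
value-strip (true ∷ w) = refl

value-≈w : ∀ {w v} → w ≈w v → value w ≡ value v
value-≈w {w} {v} eq = trans (sym (value-strip w)) (trans (cong value eq) (value-strip v))

value-< : ∀ {w} → ZF w → value w < fib (2 + length w)
value-< zf-[] = s≤s z≤n
value-< {false ∷ w} (zf-0 z) = <-≤-trans (value-< z) (fib-mono (n≤1+n (2 + length w)))
value-< zf-1 = s≤s (s≤s z≤n)
value-< (zf-10 z) = +-monoʳ-< _ (value-< z)

value-<-lead : ∀ {w} → ZF w → value w < fib (2 + lead w)
value-<-lead {w} z = subst (_< fib (2 + lead w)) (value-strip w) (value-< (ZF-strip z))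

value-lead-< : ∀ {w} v → ZF w → lead w < lead v → value w < value v
value-lead-< {w} v zw lead< with strip-lead-pos v (≤-trans (s≤s z≤n) lead<)
... | b , sv = begin-strict
  value w                     <⟨ value-<-lead zw ⟩
  fib (2 + lead w)            ≤⟨ fib-mono (s≤s (s≤s (s≤s⁻¹ (subst (lead w <_) (cong length sv) lead<)))) ⟩
  fib (2 + length b)          ≤⟨ m≤m+n _ _ ⟩
  value (true ∷ b)            ≡⟨ cong value sv ⟨
  value (strip v)             ≡⟨ value-strip v ⟩
  value v                     ∎
  where open ≤-Reasoning

value-0∷<value-10∷ : ∀ {w v} → ZF w → length w ≡ suc (length v)
                   → value (false ∷ w) < value (true ∷ false ∷ v)
value-0∷<value-10∷ {w} {v} zw eq = <-≤-trans (value-< zw)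
  (≤-trans (≤-reflexive (cong (λ n → fib (2 + n)) eq)) (m≤m+n _ _))

value-injective : ∀ {w v} → ZF w → ZF v → length w ≡ length v → value w ≡ value v → w ≡ v
value-injective zf-[] zf-[] _ _ = refl
value-injective zf-1 zf-1 _ _ = refl
value-injective (zf-0 zw) (zf-0 zv) l e = cong (false ∷_) (value-injective zw zv (suc-injective l) e)
value-injective (zf-10 {w} zw) (zf-10 {v} zv) l e =
  cong prepend10 (value-injective zw zv l′
    (+-cancelˡ-≡ _ _ _ (trans e (cong (λ n → fib (3 + n) + value v) (sym l′)))))
  where l′ = suc-injective (suc-injective l)
value-injective (zf-0 zw) (zf-10 {v} _) l e =
  ⊥-elim (<-irrefl e (value-0∷<value-10∷ {v = v} zw (suc-injective l)))
value-injective (zf-10 {w} _) (zf-0 zv) l e =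
  ⊥-elim (<-irrefl (sym e) (value-0∷<value-10∷ {v = w} zv (sym (suc-injective l))))
value-injective zf-1 (zf-0 {[]} _) _ ()
value-injective zf-1 (zf-0 {_ ∷ _} _) () _
value-injective (zf-0 {[]} _) zf-1 _ ()
value-injective (zf-0 {_ ∷ _} _) zf-1 () _
value-injective zf-[] (zf-0 _) () _
value-injective zf-[] zf-1 () _
value-injective zf-[] (zf-10 _) () _
value-injective (zf-0 _) zf-[] () _
value-injective zf-1 zf-[] () _
value-injective zf-1 (zf-10 _) () _
value-injective (zf-10 _) zf-[] () _
value-injective (zf-10 _) zf-1 () _

value-injective-≈w : ∀ {w v} → ZF w → ZF v → value w ≡ value v → w ≈w v
value-injective-≈w {w} {v} zw zv e =
  value-injective (ZF-strip zw) (ZF-strip zv) lead≡ (trans (value-strip w) (trans e (sym (value-strip v))))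
  where
  lead≡ : lead w ≡ lead v
  lead≡ with <-cmp (lead w) (lead v)
  ... | tri< w<v _ _ = ⊥-elim (<-irrefl e (value-lead-< v zw w<v))
  ... | tri≈ _ eq _ = eq
  ... | tri> _ _ v<w = ⊥-elim (<-irrefl (sym e) (value-lead-< w zv v<w))

WordOfValue : ℕ → ℕ → Set
WordOfValue k c = ∃ λ w → ZF w × length w ≡ k × value w ≡ c

value-surjective : ∀ k c → c < fib (2 + k) → WordOfValue k c
value-surjective zero zero _ = [] , zf-[] , refl , refl
value-surjective zero (suc c) (s≤s ())
value-surjective (suc zero) zero _ = false ∷ [] , zf-0 zf-[] , refl , refl
value-surjective (suc zero) (suc zero) _ = true ∷ [] , zf-1 , refl , refl
value-surjective (suc zero) (suc (suc c)) (s≤s (s≤s ()))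
value-surjective (suc (suc k)) c c<fib =
  [ (λ c<F → prepend-0 (value-surjective (suc k) c c<F))
  , (λ F≤c → prepend-10 F≤c (value-surjective k (c ∸ F) (rest<fib F≤c)))
  ]′ (<-≤-connex c F)
  where
  F = fib (3 + k)
  rest<fib : F ≤ c → c ∸ F < fib (2 + k)
  rest<fib F≤c = subst (c ∸ F <_) (m+n∸m≡n F _) (∸-monoˡ-< c<fib F≤c)
  prepend-0 : WordOfValue (suc k) c → WordOfValue (2 + k) c
  prepend-0 (w , zw , lw , vw) = false ∷ w , zf-0 zw , cong suc lw , vw
  prepend-10 : F ≤ c → WordOfValue k (c ∸ F) → WordOfValue (2 + k) c
  prepend-10 F≤c (w , zw , lw , vw) = true ∷ false ∷ w , zf-10 zw , cong (2 +_) lw ,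
    trans (cong (λ n → fib (3 + n) + value w) lw) (trans (cong (F +_) vw) (m+[n∸m]≡n F≤c))

-- Counting in a length-increasing enumeration

record LengthIncreasingEnumeration (v : ℕ → Word) : Set where
  field
    zf         : ∀ n → ZF (v n)
    surjective : ∀ w → ZF w → ∃[ n ] v n ≈w w
    injective  : ∀ m n → v m ≈w v n → m ≡ n
    lead-step  : ∀ n → lead (v n) ≤ lead (v (suc n))

module _ {v : ℕ → Word} (E : LengthIncreasingEnumeration v) where
  open LengthIncreasingEnumeration E

  lead-mono : ∀ {m n} → m ≤ n → lead (v m) ≤ lead (v n)
  lead-mono = monotone-by-steps (lead ∘ v) lead-step

  -- v 0, …, v m are distinct with values below fib (2 + k).
  index<fib : ∀ {m k} → lead (v m) ≤ k → m < fib (2 + k)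
  index<fib {m} {k} lead≤k = injection⇒≤ (value ∘ v ∘ toℕ) value<fib distinct
    where
    value<fib : ∀ (i : Fin (suc m)) → value (v (toℕ i)) < fib (2 + k)
    value<fib i = <-≤-trans (value-<-lead (zf _))
      (fib-mono (s≤s (s≤s (≤-trans (lead-mono (s≤s⁻¹ (toℕ<n i))) lead≤k))))
    distinct : ∀ i j → value (v (toℕ i)) ≡ value (v (toℕ j)) → i ≡ j
    distinct i j eq = toℕ-injective (injective _ _ (value-injective-≈w (zf _) (zf _) eq))

  -- Every value c < fib (2 + k) is taken by a word of length k, which occurs before index m.
  fib≤index : ∀ {m k} → k < lead (v m) → fib (2 + k) ≤ m
  fib≤index {m} {k} k<lead = injection⇒≤ index index<m distinct
    where
    word : Fin (fib (2 + k)) → Word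
    word c = proj₁ (value-surjective k (toℕ c) (toℕ<n c))
    word-spec : ∀ c → ZF (word c) × length (word c) ≡ k × value (word c) ≡ toℕ c
    word-spec c = proj₂ (value-surjective k (toℕ c) (toℕ<n c))
    index : Fin (fib (2 + k)) → ℕ
    index c = proj₁ (surjective (word c) (proj₁ (word-spec c)))
    at-index : ∀ c → v (index c) ≈w word c
    at-index c = proj₂ (surjective (word c) (proj₁ (word-spec c)))
    index<m : ∀ c → index c < m
    index<m c = ≰⇒> λ m≤index → <⇒≱ k<lead (begin
      lead (v m)         ≤⟨ lead-mono m≤index ⟩
      lead (v (index c)) ≡⟨ cong length (at-index c) ⟩
      lead (word c)      ≤⟨ lead≤length (word c) ⟩
      length (word c)    ≡⟨ proj₁ (proj₂ (word-spec c)) ⟩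
      k                  ∎)
      where open ≤-Reasoning
    distinct : ∀ c d → index c ≡ index d → c ≡ d
    distinct c d eq = toℕ-injective (begin
      toℕ c          ≡⟨ proj₂ (proj₂ (word-spec c)) ⟨
      value (word c) ≡⟨ value-≈w {word c} {word d}
                          (trans (sym (at-index c)) (trans (cong (strip ∘ v) eq) (at-index d))) ⟩
      value (word d) ≡⟨ proj₂ (proj₂ (word-spec d)) ⟩
      toℕ d          ∎)
      where open ≡-Reasoning

  lead≤⇔ : ∀ m k → lead (v m) ≤ k ⇔ m < fib (2 + k)
  lead≤⇔ m k = mk⇔ index<fib λ m<fib → ≮⇒≥ λ k<lead → <⇒≱ m<fib (fib≤index k<lead)

-- Hamming distance

hamRev-sym : ∀ a b → hamRev a b ≡ hamRev b a
hamRev-sym [] [] = refl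
hamRev-sym [] (true ∷ b) = cong suc (hamRev-sym [] b)
hamRev-sym [] (false ∷ b) = hamRev-sym [] b
hamRev-sym (true ∷ a) [] = cong suc (hamRev-sym a [])
hamRev-sym (false ∷ a) [] = hamRev-sym a []
hamRev-sym (true ∷ a) (true ∷ b) = hamRev-sym a b
hamRev-sym (true ∷ a) (false ∷ b) = cong suc (hamRev-sym a b)
hamRev-sym (false ∷ a) (true ∷ b) = cong suc (hamRev-sym a b)
hamRev-sym (false ∷ a) (false ∷ b) = hamRev-sym a b

hamRev-∷ʳ-false : ∀ a b → hamRev (a ∷ʳ false) b ≡ hamRev a b
hamRev-∷ʳ-false [] [] = refl
hamRev-∷ʳ-false [] (true ∷ b) = refl
hamRev-∷ʳ-false [] (false ∷ b) = refl
hamRev-∷ʳ-false (true ∷ a) [] = cong suc (hamRev-∷ʳ-false a [])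
hamRev-∷ʳ-false (false ∷ a) [] = hamRev-∷ʳ-false a []
hamRev-∷ʳ-false (true ∷ a) (true ∷ b) = hamRev-∷ʳ-false a b
hamRev-∷ʳ-false (true ∷ a) (false ∷ b) = cong suc (hamRev-∷ʳ-false a b)
hamRev-∷ʳ-false (false ∷ a) (true ∷ b) = cong suc (hamRev-∷ʳ-false a b)
hamRev-∷ʳ-false (false ∷ a) (false ∷ b) = hamRev-∷ʳ-false a b

hamRev-++ : ∀ a b {c d} → length a ≡ length b → hamRev (a ++ c) (b ++ d) ≡ hamRev a b + hamRev c d
hamRev-++ [] [] _ = refl
hamRev-++ (true ∷ a) (true ∷ b) l = hamRev-++ a b (suc-injective l)
hamRev-++ (true ∷ a) (false ∷ b) l = cong suc (hamRev-++ a b (suc-injective l))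
hamRev-++ (false ∷ a) (true ∷ b) l = cong suc (hamRev-++ a b (suc-injective l))
hamRev-++ (false ∷ a) (false ∷ b) l = hamRev-++ a b (suc-injective l)

reverse-≈w-∷ : ∀ x a b → reverse a ≈w reverse b → reverse (x ∷ a) ≈w reverse (x ∷ b)
reverse-≈w-∷ x a b eq = subst₂ _≈w_ (sym (unfold-reverse x a)) (sym (unfold-reverse x b))
  (≈w-++ʳ {reverse a} {reverse b} (x ∷ []) eq)

hamRev≡0 : ∀ a b → hamRev a b ≡ 0 → reverse a ≈w reverse b
hamRev≡0 [] [] _ = refl
hamRev≡0 [] (false ∷ b) h = reverse-≈w-∷ false [] b (hamRev≡0 [] b h)
hamRev≡0 (false ∷ a) [] h = reverse-≈w-∷ false a [] (hamRev≡0 a [] h)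
hamRev≡0 (true ∷ a) (true ∷ b) h = reverse-≈w-∷ true a b (hamRev≡0 a b h)
hamRev≡0 (false ∷ a) (false ∷ b) h = reverse-≈w-∷ false a b (hamRev≡0 a b h)
hamRev≡0 [] (true ∷ b) ()
hamRev≡0 (true ∷ a) [] ()
hamRev≡0 (true ∷ a) (false ∷ b) ()
hamRev≡0 (false ∷ a) (true ∷ b) ()

ham-sym : ∀ w v → ham w v ≡ ham v w
ham-sym w v = hamRev-sym (reverse w) (reverse v)

ham≡0⇒≈w : ∀ w v → ham w v ≡ 0 → w ≈w v
ham≡0⇒≈w w v h = subst₂ _≈w_ (reverse-involutive w) (reverse-involutive v)
  (hamRev≡0 (reverse w) (reverse v) (trans (sym (ham-reverse w v)) h))

ham-false-∷ : ∀ w v → ham (false ∷ w) v ≡ ham w v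
ham-false-∷ w v = trans (cong (λ a → hamRev a (reverse v)) (unfold-reverse false w))
  (hamRev-∷ʳ-false (reverse w) (reverse v))

ham-∷-false : ∀ w v → ham w (false ∷ v) ≡ ham w v
ham-∷-false w v = trans (ham-sym w (false ∷ v)) (trans (ham-false-∷ v w) (ham-sym v w))

ham-strip : ∀ w v → ham w v ≡ ham (strip w) (strip v)
ham-strip [] [] = refl
ham-strip (false ∷ w) v = trans (ham-false-∷ w v) (ham-strip w v)
ham-strip [] (false ∷ v) = trans (ham-∷-false [] v) (ham-strip [] v)
ham-strip (true ∷ w) (false ∷ v) = trans (ham-∷-false (true ∷ w) v) (ham-strip (true ∷ w) v)
ham-strip [] (true ∷ v) = refl
ham-strip (true ∷ w) [] = refl
ham-strip (true ∷ w) (true ∷ v) = refl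

ham-∷ : ∀ x y w v → length w ≡ length v → ham (x ∷ w) (y ∷ v) ≡ ham w v + ham (x ∷ []) (y ∷ [])
ham-∷ x y w v l = trans (cong₂ hamRev (unfold-reverse x w) (unfold-reverse y v))
  (hamRev-++ (reverse w) (reverse v) (trans (length-reverse w) (trans l (sym (length-reverse v)))))

ham-same-∷ : ∀ x w v → length w ≡ length v → ham (x ∷ w) (x ∷ v) ≡ ham w v
ham-same-∷ x w v l = trans (ham-∷ x x w v l) (trans (cong (ham w v +_) (ham-self x)) (+-identityʳ _))
  where
  ham-self : ∀ x → ham (x ∷ []) (x ∷ []) ≡ 0
  ham-self true = refl
  ham-self false = refl

ham-refl : ∀ w → ham w w ≡ 0
ham-refl [] = refl
ham-refl (x ∷ w) = trans (ham-same-∷ x w w refl) (ham-refl w)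

ham-1∷-10∷ : ∀ {a b} → length a ≡ length b → ham (true ∷ a) (true ∷ false ∷ b) ≡ ham a b + 2
ham-1∷-10∷ {a} {b} l = begin
  ham (true ∷ a) (true ∷ false ∷ b)           ≡⟨ ham-false-∷ (true ∷ a) (true ∷ false ∷ b) ⟨
  ham (false ∷ true ∷ a) (true ∷ false ∷ b)   ≡⟨ ham-∷ false true (true ∷ a) (false ∷ b) (cong suc l) ⟩
  ham (true ∷ a) (false ∷ b) + 1              ≡⟨ cong (_+ 1) (ham-∷ true false a b l) ⟩
  ham a b + 1 + 1                             ≡⟨ +-assoc (ham a b) 1 1 ⟩
  ham a b + 2                                 ∎
  where open ≡-Reasoning

lead-suc⇒2≤ham : ∀ {w v} → ZF v → Nonzero w → lead v ≡ suc (lead w) → 2 ≤ ham w v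
lead-suc⇒2≤ham {w} {v} zv nzw lead≡
  with a , sw ← strip-lead-pos w (nonzero⇒lead-pos nzw)
     | b , sv ← strip-lead-pos v (subst (1 ≤_) (sym lead≡) (s≤s z≤n)) =
  subst (2 ≤_) (sym (trans (ham-strip w v) (cong₂ ham sw sv)))
    (shape (subst ZF sv (ZF-strip zv))
           (suc-injective (trans (sym (cong length sv)) (trans lead≡ (cong (suc ∘ length) sw)))))
  where
  shape : ∀ {b} → ZF (true ∷ b) → length b ≡ suc (length a) → 2 ≤ ham (true ∷ a) (true ∷ b)
  shape (zf-10 {b′} _) l =
    subst (2 ≤_) (sym (ham-1∷-10∷ {a} {b′} (sym (suc-injective l)))) (m≤n+m 2 (ham a b′))

-- The blocks N n are Gray codes

prepend10-tail : Word → Word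
prepend10-tail = prepend10 ∘ drop 1

primeL≡map-drop1 : ∀ xs → primeL xs ≡ map (drop 1) xs
primeL≡map-drop1 [] = refl
primeL≡map-drop1 ([] ∷ xs) = cong ([] ∷_) (primeL≡map-drop1 xs)
primeL≡map-drop1 ((_ ∷ w) ∷ xs) = cong (w ∷_) (primeL≡map-drop1 xs)

N-unfold : ∀ n → N (suc (suc n)) ≡ reverse (map prepend10-tail (N (suc n))) ++ reverse (map prepend10 (N n))
N-unfold n = cong₂ _++_ first-half (reverse-map prepend10 (N n))
  where
  open ≡-Reasoning
  first-half : pre10 (reverse (primeL (N (suc n)))) ≡ reverse (map prepend10-tail (N (suc n)))
  first-half = begin
    map prepend10 (reverse (primeL (N (suc n))))
      ≡⟨ reverse-map prepend10 (primeL (N (suc n))) ⟩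
    reverse (map prepend10 (primeL (N (suc n))))
      ≡⟨ cong (reverse ∘ map prepend10) (primeL≡map-drop1 (N (suc n))) ⟩
    reverse (map prepend10 (map (drop 1) (N (suc n))))
      ≡⟨ cong reverse (map-∘ (N (suc n))) ⟨
    reverse (map prepend10-tail (N (suc n)))
      ∎

length-N : ∀ n → length (N n) ≡ fib n
length-N zero = refl
length-N (suc zero) = refl
length-N (suc (suc n)) = begin
  length (N (suc (suc n)))
    ≡⟨ cong length (N-unfold n) ⟩
  length (reverse (map prepend10-tail (N (suc n))) ++ reverse (map prepend10 (N n)))
    ≡⟨ length-++ (reverse (map prepend10-tail (N (suc n)))) ⟩
  length (reverse (map prepend10-tail (N (suc n)))) + length (reverse (map prepend10 (N n)))
    ≡⟨ cong₂ _+_ (length-reverse-map prepend10-tail (N (suc n))) (length-reverse-map prepend10 (N n)) ⟩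
  length (N (suc n)) + length (N n)
    ≡⟨ cong₂ _+_ (length-N (suc n)) (length-N n) ⟩
  fib (suc n) + fib n
    ∎
  where
  open ≡-Reasoning
  length-reverse-map : ∀ (h : Word → Word) xs → length (reverse (map h xs)) ≡ length xs
  length-reverse-map h xs = trans (length-reverse (map h xs)) (length-map h xs)

data Leading1 (L : ℕ) : Word → Set where
  leading1 : ∀ {w} → length w ≡ L → Leading1 L (true ∷ w)

Close : Word → Word → Set
Close a b = ham a b ≤ 1

Close-sym : Symmetric Close
Close-sym {a} {b} = subst (_≤ 1) (ham-sym a b)

Close-prepend10 : ∀ {a b} → length a ≡ length b → Close a b → Close (prepend10 a) (prepend10 b)
Close-prepend10 {a} {b} l = subst (_≤ 1) (sym (begin
  ham (prepend10 a) (prepend10 b) ≡⟨ ham-same-∷ true (false ∷ a) (false ∷ b) (cong suc l) ⟩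
  ham (false ∷ a) (false ∷ b)     ≡⟨ ham-same-∷ false a b l ⟩
  ham a b                         ∎))
  where open ≡-Reasoning

Close-prepend10-tail : ∀ {L a b} → Leading1 L a → Leading1 L b → Close a b
                     → Close (prepend10-tail a) (prepend10-tail b)
Close-prepend10-tail {a = true ∷ a} {true ∷ b} (leading1 la) (leading1 lb) =
  Close-prepend10 {a} {b} l ∘ subst (_≤ 1) (ham-same-∷ true a b l)
  where l = trans la (sym lb)

Close-prepend10-leading : ∀ {L a b} → Leading1 L a → Leading1 L b → Close a b
                        → Close (prepend10 a) (prepend10 b)
Close-prepend10-leading {a = true ∷ a} {true ∷ b} (leading1 la) (leading1 lb) =
  Close-prepend10 {true ∷ a} {true ∷ b} (cong suc (trans la (sym lb)))

Close-reverse-map : ∀ {P : Word → Set} (f : Word → Word)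
                  → (∀ {a b} → P a → P b → Close a b → Close (f a) (f b))
                  → ∀ {xs} → All P xs → Linked Close xs → Linked Close (reverse (map f xs))
Close-reverse-map f step ps cs =
  Linked-reverse (λ {a} {b} → Close-sym {a} {b}) (Linked.map⁺ (Linked-map-All step ps cs))

record GrayBlock (L : ℕ) : Set where
  field
    close   : Linked Close (N (suc L))
    leading : All (Leading1 L) (N (suc L))
    final   : Word
    last-N  : last (N (suc L)) ≡ just (true ∷ final)

head-N-next : ∀ n {l} → last (N (suc n)) ≡ just (true ∷ l) → head (N (suc (suc n))) ≡ just (prepend10 l)
head-N-next n {l} last≡ =
  trans (cong head (N-unfold n)) (head-++ (reverse (map prepend10-tail (N (suc n)))) first-half)
  where
  open ≡-Reasoning
  first-half : head (reverse (map prepend10-tail (N (suc n)))) ≡ just (prepend10 l)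
  first-half = begin
    head (reverse (map prepend10-tail (N (suc n)))) ≡⟨ head-reverse (map prepend10-tail (N (suc n))) ⟩
    last (map prepend10-tail (N (suc n)))           ≡⟨ last-map prepend10-tail (N (suc n)) ⟩
    Maybe.map prepend10-tail (last (N (suc n)))     ≡⟨ cong (Maybe.map prepend10-tail) last≡ ⟩
    just (prepend10 l)                              ∎

N-junction : ∀ n {l} → last (N (suc n)) ≡ just (true ∷ l)
           → Connected Close (last (reverse (map prepend10-tail (N (2 + n)))))
                             (head (reverse (map prepend10 (N (suc n)))))
N-junction n {l} last≡ =
  subst₂ (Connected Close) (sym last-left) (sym head-right) (just (≤-reflexive differ-once))
  where
  last-left : last (reverse (map prepend10-tail (N (2 + n)))) ≡ just (prepend10 (false ∷ l))
  last-left = trans (last-reverse (map prepend10-tail (N (2 + n))))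
    (trans (head-map (N (2 + n))) (cong (Maybe.map prepend10-tail) (head-N-next n last≡)))
  head-right : head (reverse (map prepend10 (N (suc n)))) ≡ just (prepend10 (true ∷ l))
  head-right = trans (head-reverse (map prepend10 (N (suc n))))
    (trans (last-map prepend10 (N (suc n))) (cong (Maybe.map prepend10) last≡))
  differ-once : ham (prepend10 (false ∷ l)) (prepend10 (true ∷ l)) ≡ 1
  differ-once = trans (ham-same-∷ true (false ∷ false ∷ l) (false ∷ true ∷ l) refl)
    (trans (ham-same-∷ false (false ∷ l) (true ∷ l) refl)
    (trans (ham-∷ false true l l refl) (cong (_+ 1) (ham-refl l))))

grayBlock-step : ∀ {L} → GrayBlock L → GrayBlock (suc L) → GrayBlock (suc (suc L))
grayBlock-step {L} B A = record
  { close   = subst (Linked Close) (sym (N-unfold (suc L)))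
                (Linked.++⁺ (Close-reverse-map prepend10-tail Close-prepend10-tail A.leading A.close)
                            (N-junction L B.last-N)
                            (Close-reverse-map prepend10 Close-prepend10-leading B.leading B.close))
  ; leading = subst (All (Leading1 (2 + L))) (sym (N-unfold (suc L)))
                (All.++⁺ (All-reverse (All.map⁺ (All.map (λ { (leading1 l) → leading1 (cong suc l) }) A.leading)))
                         (All-reverse (All.map⁺ (All.map (λ { (leading1 l) → leading1 (cong (2 +_) l) }) B.leading))))
  ; final   = false ∷ head-B
  ; last-N  = subst (λ xs → last xs ≡ just (prepend10 head-B)) (sym (N-unfold (suc L)))
                (last-++ (reverse (map prepend10-tail (N (2 + L))))
                  (trans (last-reverse (map prepend10 (N (suc L))))
                    (trans (head-map (N (suc L))) (cong (Maybe.map prepend10) head-B≡))))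
  }
  where
  module A = GrayBlock A
  module B = GrayBlock B
  head-B = proj₁ (last≡just⇒head≡just (N (suc L)) B.last-N)
  head-B≡ = proj₂ (last≡just⇒head≡just (N (suc L)) B.last-N)

grayBlocks : ∀ L → GrayBlock L × GrayBlock (suc L)
grayBlocks zero = record { close = [-] ; leading = leading1 refl ∷ [] ; final = [] ; last-N = refl }
                , record { close = [-] ; leading = leading1 refl ∷ [] ; final = false ∷ [] ; last-N = refl }
grayBlocks (suc L) = proj₂ (grayBlocks L) , grayBlock-step (proj₁ (grayBlocks L)) (proj₂ (grayBlocks L))

grayBlock : ∀ L → GrayBlock L
grayBlock L = proj₁ (grayBlocks L)

-- The sequence g

nth-∈ : ∀ xs {k} → k < length xs → nth xs k ∈ xs
nth-∈ (x ∷ xs) {zero} _ = here refl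
nth-∈ (x ∷ xs) {suc k} (s≤s k<n) = there (nth-∈ xs k<n)

nth-++ˡ : ∀ xs {ys k} → k < length xs → nth (xs ++ ys) k ≡ nth xs k
nth-++ˡ (x ∷ xs) {k = zero} _ = refl
nth-++ˡ (x ∷ xs) {k = suc k} (s≤s k<n) = nth-++ˡ xs k<n

nth-++-∈ʳ : ∀ xs {ys k} → length xs ≤ k → k < length (xs ++ ys) → nth (xs ++ ys) k ∈ ys
nth-++-∈ʳ [] {ys} _ k<n = nth-∈ ys k<n
nth-++-∈ʳ (x ∷ xs) {k = suc k} (s≤s n≤k) (s≤s k<n) = nth-++-∈ʳ xs n≤k k<n

Linked-nth : ∀ {R : Word → Word → Set} {xs k} → Linked R xs → suc k < length xs → R (nth xs k) (nth xs (suc k))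
Linked-nth {k = zero} (Rxy ∷ _) _ = Rxy
Linked-nth {k = suc k} (_ ∷ Rxs) (s≤s k<n) = Linked-nth Rxs k<n
Linked-nth [-] (s≤s ())

Step : Word → Word → Set
Step a b = Close a b ⊎ (lead b ≡ suc (lead a) × ham a b ≤ 2)

Nupto-linked : ∀ K → Linked Step (Nupto K)
Nupto-linked zero = []
Nupto-linked (suc K) =
  Linked.++⁺ (Nupto-linked K) (junction K) (Linked.map inj₁ (GrayBlock.close (grayBlock K)))
  where
  junction : ∀ K → Connected Step (last (Nupto K)) (head (N (suc K)))
  junction zero = nothing-just
  junction (suc K) = subst₂ (Connected Step) (sym last-Nupto) (sym (head-N-next K last-N))
    (just (inj₂ (refl , ≤-reflexive (trans (ham-1∷-10∷ {l} {l} refl) (cong (_+ 2) (ham-refl l))))))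
    where
    open GrayBlock (grayBlock K) using (last-N) renaming (final to l)
    last-Nupto : last (Nupto (suc K)) ≡ just (true ∷ l)
    last-Nupto = last-++ (Nupto K) last-N

length-Nupto : ∀ K → suc (length (Nupto K)) ≡ fib (2 + K)
length-Nupto zero = refl
length-Nupto (suc K) = trans (cong suc (length-++ (Nupto K))) (cong₂ _+_ (length-Nupto K) (length-N (suc K)))

K≤length-Nupto : ∀ K → K ≤ length (Nupto K)
K≤length-Nupto zero = z≤n
K≤length-Nupto (suc K) = begin
  suc K                                 ≡⟨ +-comm 1 K ⟩
  K + 1                                 ≤⟨ +-mono-≤ (K≤length-Nupto K) N-nonempty ⟩
  length (Nupto K) + length (N (suc K)) ≡⟨ length-++ (Nupto K) ⟨
  length (Nupto (suc K))                ∎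
  where
  open ≤-Reasoning
  N-nonempty : 1 ≤ length (N (suc K))
  N-nonempty = subst (1 ≤_) (sym (length-N (suc K))) (fib-mono {1} {suc K} (s≤s z≤n))

lead-Nupto : ∀ K → All (λ w → lead w ≤ K) (Nupto K)
lead-Nupto zero = []
lead-Nupto (suc K) =
  All.++⁺ (All.map m≤n⇒m≤1+n (lead-Nupto K)) (All.map lead-block (GrayBlock.leading (grayBlock K)))
  where
  lead-block : ∀ {w} → Leading1 K w → lead w ≤ suc K
  lead-block (leading1 lw) = s≤s (≤-reflexive lw)

Nupto-prefix : ∀ {K M} → K ≤ M → ∃ λ R → Nupto M ≡ Nupto K ++ R × All (λ w → K < lead w) R
Nupto-prefix {M = zero} z≤n = [] , refl , []
Nupto-prefix {K} {suc M} K≤1+M with m≤n⇒m<n∨m≡n K≤1+M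
... | inj₂ refl = [] , sym (++-identityʳ _) , []
... | inj₁ K<1+M =
  let R , eq , later = Nupto-prefix (s≤s⁻¹ K<1+M)
  in R ++ N (suc M) , trans (cong (_++ N (suc M)) eq) (++-assoc (Nupto K) R _) ,
     All.++⁺ later (All.map lead-block (GrayBlock.leading (grayBlock M)))
  where
  lead-block : ∀ {w} → Leading1 M w → K < lead w
  lead-block (leading1 lw) = s≤s (≤-trans (s≤s⁻¹ K<1+M) (≤-reflexive (sym lw)))

g-nth : ∀ {k M} → suc k ≤ M → g (suc k) ≡ nth (Nupto M) k
g-nth {k} le with R , eq , _ ← Nupto-prefix le =
  trans (g-suc k) (sym (trans (cong (λ xs → nth xs k) eq) (nth-++ˡ (Nupto (suc k)) (K≤length-Nupto (suc k)))))

g-step : ∀ k → Step (g (suc k)) (g (suc (suc k)))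
g-step k = subst₂ Step (sym (g-nth (n≤1+n (suc k)))) (sym (g-suc (suc k)))
  (Linked-nth (Nupto-linked (2 + k)) (K≤length-Nupto (2 + k)))

lead-g≤⇔ : ∀ k K → lead (g (suc k)) ≤ K ⇔ k < length (Nupto K)
lead-g≤⇔ k K with R , eq , later ← Nupto-prefix (m≤m+n K (suc k)) = mk⇔ to from
  where
  g≡ : g (suc k) ≡ nth (Nupto K ++ R) k
  g≡ = trans (g-nth (m≤n+m (suc k) K)) (cong (λ xs → nth xs k) eq)
  to : lead (g (suc k)) ≤ K → k < length (Nupto K)
  to lead≤K = ≰⇒> λ length≤k →
    <⇒≱ (All.lookup later (nth-++-∈ʳ (Nupto K) length≤k k<length)) (subst (λ w → lead w ≤ K) g≡ lead≤K)
    where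
    k<length : k < length (Nupto K ++ R)
    k<length = subst (k <_) (cong length eq) (≤-trans (m≤n+m (suc k) K) (K≤length-Nupto (K + suc k)))
  from : k < length (Nupto K) → lead (g (suc k)) ≤ K
  from k< = subst (λ w → lead w ≤ K) (sym (trans g≡ (nth-++ˡ (Nupto K) k<)))
    (All.lookup (lead-Nupto K) (nth-∈ (Nupto K) k<))

lead-g≡lead : ∀ {v} → LengthIncreasingEnumeration v → ∀ k → lead (g (suc k)) ≡ lead (v (suc k))
lead-g≡lead E k = ≤-determined λ K → ⇔.trans (lead-g≤⇔ k K) (⇔.trans (shift K) (⇔.sym (lead≤⇔ E (suc k) K)))
  where
  shift : ∀ K → k < length (Nupto K) ⇔ suc k < fib (2 + K)
  shift K = mk⇔ (λ k< → subst (suc k <_) (length-Nupto K) (s≤s k<))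
                (λ k< → s≤s⁻¹ (subst (suc k <_) (sym (length-Nupto K)) k<))

zeroExtension : (ℕ → Word) → ℕ → Word
zeroExtension u zero = []
zeroExtension u (suc n) = u (suc n)

zeroExtension-enumeration : (u : ℕ → Word)
  → (∀ n → 1 ≤ n → ZF (u n) × Nonzero (u n))
  → (∀ w → ZF w → Nonzero w → ∃[ n ] (1 ≤ n × u n ≈w w))
  → (∀ m k → 1 ≤ m → 1 ≤ k → u m ≈w u k → m ≡ k)
  → (∀ n → 1 ≤ n → lead (u n) ≤ lead (u (suc n)))
  → LengthIncreasingEnumeration (zeroExtension u)
zeroExtension-enumeration u u-zf u-onto u-inj u-step = record
  { zf = zf ; surjective = surjective ; injective = injective ; lead-step = lead-step }
  where
  zf : ∀ n → ZF (zeroExtension u n)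
  zf zero = zf-[]
  zf (suc n) = proj₁ (u-zf (suc n) (s≤s z≤n))
  surjective : ∀ w → ZF w → ∃[ n ] zeroExtension u n ≈w w
  surjective w zw with strip≡[]⊎nonzero w
  ... | inj₁ strip≡[] = zero , sym strip≡[]
  ... | inj₂ nz with u-onto w zw nz
  ...   | suc n , _ , u≈w = suc n , u≈w
  strip≢[] : ∀ n → strip (u (suc n)) ≢ []
  strip≢[] n eq = <⇒≱ (nonzero⇒lead-pos (proj₂ (u-zf (suc n) (s≤s z≤n)))) (≤-reflexive (cong length eq))
  injective : ∀ m n → zeroExtension u m ≈w zeroExtension u n → m ≡ n
  injective zero zero _ = refl
  injective zero (suc n) eq = ⊥-elim (strip≢[] n (sym eq))
  injective (suc m) zero eq = ⊥-elim (strip≢[] m eq)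
  injective (suc m) (suc n) eq = u-inj (suc m) (suc n) (s≤s z≤n) (s≤s z≤n) eq
  lead-step : ∀ n → lead (zeroExtension u n) ≤ lead (zeroExtension u (suc n))
  lead-step zero = z≤n
  lead-step (suc n) = u-step (suc n) (s≤s z≤n)

theorem2p8 : (u : ℕ → Word)
    → (∀ n → 1 ≤ n → ZF (u n) × Nonzero (u n))
    → (∀ w → ZF w → Nonzero w → ∃[ n ] (1 ≤ n × u n ≈w w))
    → (∀ m k → 1 ≤ m → 1 ≤ k → u m ≈w u k → m ≡ k)
    → (∀ n → 1 ≤ n → lead (u n) ≤ lead (u (suc n)))
    → ∀ n → 1 ≤ n → ham (g n) (g (suc n)) ≤ ham (u n) (u (suc n))
theorem2p8 u u-zf u-onto u-inj u-step (suc k) _ = [ from-close , from-lead-suc ]′ (g-step k)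
  where
  n = suc k
  E = zeroExtension-enumeration u u-zf u-onto u-inj u-step
  from-close : Close (g n) (g (suc n)) → ham (g n) (g (suc n)) ≤ ham (u n) (u (suc n))
  from-close close = ≤-trans close (n≢0⇒n>0 λ ham≡0 →
    <⇒≢ (n<1+n n) (u-inj n (suc n) (s≤s z≤n) (s≤s z≤n) (ham≡0⇒≈w (u n) (u (suc n)) ham≡0)))
  from-lead-suc : lead (g (suc n)) ≡ suc (lead (g n)) × ham (g n) (g (suc n)) ≤ 2
                → ham (g n) (g (suc n)) ≤ ham (u n) (u (suc n))
  from-lead-suc (lead-suc , ham≤2) = ≤-trans ham≤2
    (lead-suc⇒2≤ham (proj₁ (u-zf (suc n) (s≤s z≤n))) (proj₂ (u-zf n (s≤s z≤n)))
      (trans (sym (lead-g≡lead E n)) (trans lead-suc (cong suc (lead-g≡lead E k)))))
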